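{- Let $\langle V,S\rangle$ be a program over a signature $\Sigma$ with largest priority $n$, and let $\mathbb P$ be a path in a (possibly infinite) derivation in the infinitary generational typing system, from $z^\alpha:\omega\vdash_\Omega P::(w^\beta:C)$ up to $x^\gamma:\omega'\vdash_{\Omega'}P'::(y^\delta:C')$ (both left channels nonempty). Then: (a) for every $i\in\mathtt c(\omega')$ with $\epsilon(i)=\mu$, if $x^\gamma_i\le_{\Omega'}z^\alpha_i$ then $x=z$ and $i\in\mathtt c(\omega)$; (b) for every $i<n$, if $x^\gamma_i<_{\Omega'}z^\alpha_i$ then $i\in\mathtt c(\omega)$ and a $\mu L$ rule with priority $i$ is applied on $\mathbb P$; (c) for every $c\le n$ with $\epsilon(c)=\nu$, if $x^\gamma_c\le_{\Omega'}z^\alpha_c$ then no $\nu L$ rule with priority $c$ is applied on $\mathbb P$.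
   Context: Signature $\Sigma$: finite set of definitions $t=^i_aA$ ($t$ defined at most once, polarity $a\in\{\mu,\nu\}$, priority $i$ a positive integer; equal priorities have equal polarity); $p(t)$ priority of $t$, $\epsilon(i)$ polarity of priority $i$. Types $A::=\oplus\{\ell:A_\ell\}_{\ell\in L}\mid\&\{\ell:A_\ell\}_{\ell\in L}\mid1\mid t$. Visibility: $\mathtt c(1;\Delta)=\emptyset$, $\mathtt c(\oplus\{\ell:A_\ell\};\Delta)=\mathtt c(\&\{\ell:A_\ell\};\Delta)=\bigcup_\ell\mathtt c(A_\ell;\Delta)$, $\mathtt c(t;\Delta)=\{t\}\cup\mathtt c(A;\Delta\cup\{t\})$ if $t=_aA\in\Sigma$, $t\notin\Delta$, and $\{t\}$ if $t\in\Delta$; $\mathtt c(A)=\{p(t):t\in\mathtt c(A;\emptyset)\}$. Processes: forward $y\leftarrow x$, cut $(x\leftarrow P_x;Q_x)$, $Rx.k;P$, $\mathbf{case}\,Lx(\ell\Rightarrow Q_\ell)$, $\mathbf{case}\,Rx(\ell\Rightarrow P_\ell)$, $Lx.k;P$, $\mathbf{close}\,Rx$, $\mathbf{wait}\,Lx;Q$, $Rx.\mu_t;P$, $\mathbf{case}\,Lx(\mu_t\Rightarrow P)$, $\mathbf{case}\,Rx(\nu_t\Rightarrow P)$, $Lx.\nu_t;P$, call $y\leftarrow X\leftarrow\bar x$; program $\langle V,S\rangle$ with definitions $\bar x:\omega\vdash X=P_{\bar x,y}::(y:C)$. Generational judgments $\bar x^\alpha:\omega\vdash_\Omega P::(y^\beta:C)$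 with $\Omega$ a set of constraints $a<b$, $a=b$ on symbols $x^\alpha_i$; $a\le_\Omega b$ iff a chain of constraints of $\Omega$ leads from $a$ to $b$ (equations usable in both directions), $a<_\Omega b$ iff such a chain has a strict step. Infinitary rules ($j$ ranges over priorities of $\Sigma$): Id: $x^\alpha:A\vdash_\Omega y^\beta\leftarrow x^\alpha::(y^\beta:A)$. Cut: from $\bar x^\alpha:\omega\vdash_{\Omega\cup\mathtt r(y^\beta)}P_{w^0}::(w^0:A)$ and $w^0:A\vdash_{\Omega\cup\mathtt r(\bar x^\alpha)}Q_{w^0}::(y^\beta:C)$ infer $\bar x^\alpha:\omega\vdash_\Omega(w\leftarrow P_w;Q_w)::(y^\beta:C)$ where $\mathtt r(v)=\{w^0_i=v_i:i\le n,i\notin\mathtt c(A)\}$ and $w$ does not occur in $\Omega$. $\oplus R$, $\oplus L$, $\&R$, $\&L$ (e.g. from $x^\alpha:A_k\vdash_\Omega P::(y^\beta:C)$ infer $x^\alpha:\&\{\ell:A_\ell\}\vdash_\Omega Lx^\alpha.k;P::(y^\beta:C)$), $1R$: $\cdot\vdash_\Omega\mathbf{close}\,Ry^\beta::(y^\beta:1)$, $1L$: from $\cdot\vdash_\Omega Q::(y^\beta:C)$ infer $x^\alpha:1\vdash_\Omega\mathbf{wait}\,Lx^\alpha;Q::(y^\beta:C)$ — all with $\Omega$ unchanged. $\mu R$ ($t=_\mu A$): from $\bar x^\alpha:\omega\vdash_{\Omega'}P_{y^{\beta+1}}::(y^{\beta+1}:A)$, $\Omega'=\Omega\cup\{y^\beta_j=y^{\beta+1}_j:j\ne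 p(t)\}$, infer $\bar x^\alpha:\omega\vdash_\Omega Ry^\beta.\mu_t;P_{y^\beta}::(y^\beta:t)$. $\mu L$ ($t=_\mu A$): from $x^{\alpha+1}:A\vdash_{\Omega'}Q_{x^{\alpha+1}}::(y^\beta:C)$, $\Omega'=\Omega\cup\{x^{\alpha+1}_{p(t)}<x^\alpha_{p(t)}\}\cup\{x^{\alpha+1}_j=x^\alpha_j:j\ne p(t)\}$, infer $x^\alpha:t\vdash_\Omega\mathbf{case}\,Lx^\alpha(\mu_t\Rightarrow Q_{x^\alpha})::(y^\beta:C)$. $\nu R$ ($t=_\nu A$): from $\bar x^\alpha:\omega\vdash_{\Omega'}P_{y^{\beta+1}}::(y^{\beta+1}:A)$, $\Omega'=\Omega\cup\{y^{\beta+1}_{p(t)}<y^\beta_{p(t)}\}\cup\{y^{\beta+1}_j=y^\beta_j:j\ne p(t)\}$, infer $\mathbf{case}\,Ry^\beta(\nu_t\Rightarrow P_{y^\beta})::(y^\beta:t)$. $\nu L$ ($t=_\nu A$): from $x^{\alpha+1}:A\vdash_{\Omega'}Q_{x^{\alpha+1}}::(y^\beta:C)$, $\Omega'=\Omega\cup\{x^{\alpha+1}_j=x^\alpha_j:j\ne p(t)\}$, infer $x^\alpha:t\vdash_\Omega Lx^\alpha.\nu_t;Q_{x^\alpha}::(y^\beta:C)$. New generations never occur in $\Omega$. Def$(X)$: from $\bar x^\alpha:\omega\vdash_\Omega P_{\bar x^\alpha,y^\beta}::(y^\beta:C)$ with $X$'s definition in $V$ infer $\bar x^\alpha:\omega\vdash_\Omega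 y^\beta\leftarrow X\leftarrow\bar x^\alpha::(y^\beta:C)$. A path is a sequence of judgments of a derivation each a premise of the rule concluding the previous one; a rule is applied on the path if it concludes one of its judgments other than the topmost. A "$\mu L$ rule with priority $i$" is an instance of $\mu L$ for a type variable $t$ with $p(t)=i$ (similarly for other fixed point rules). -}

module Defs where

open import Data.Nat using (ℕ; zero; suc; _≤_; _<_)
open import Data.Fin using (Fin; toℕ)
open import Data.Bool using (Bool; true; false)
open import Data.Maybe using (Maybe; just; nothing)
import Data.Maybe as Maybe
open import Data.List using (List; []; _∷_)
open import Data.List.Membership.Propositional using (_∈_)
open import Data.Product using (Σ; ∃; ∃-syntax; _×_; _,_)
open import Data.Sum using (_⊎_)
open import Data.Unit using (⊤)
open import Data.Empty using (⊥)
open import Relation.Nullary using (¬_)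
open import Relation.Binary.PropositionalEquality using (_≡_; _≢_)

data Pol : Set where
  μ ν : Pol

-- ⊕{ℓ:A_ℓ}_{ℓ∈L} and &{ℓ:A_ℓ}_{ℓ∈L} with label set L = Fin k
data Ty (m : ℕ) : Set where
  plus : (k : ℕ) → (Fin k → Ty m) → Ty m
  wth  : (k : ℕ) → (Fin k → Ty m) → Ty m
  one  : Ty m
  var  : Fin m → Ty m

record Sig : Set where
  field
    m        : ℕ
    body     : Fin m → Ty m
    pol      : Fin m → Pol
    prio     : Fin m → ℕ
    prio-pos : ∀ t → 1 ≤ prio t
    pol-coh  : ∀ s t → prio s ≡ prio t → pol s ≡ pol t

module _ (S : Sig) where
  open Sig S

  -- Vis A Δ t  :⇔  t ∈ c(A;Δ)   (the recursive definition of c(A;Δ))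
  data Vis : Ty m → List (Fin m) → Fin m → Set where
    v-plus : ∀ {k f Δ t} (ℓ : Fin k) → Vis (f ℓ) Δ t → Vis (plus k f) Δ t
    v-wth  : ∀ {k f Δ t} (ℓ : Fin k) → Vis (f ℓ) Δ t → Vis (wth k f) Δ t
    v-self : ∀ {Δ t} → Vis (var t) Δ t
    v-unf  : ∀ {Δ s t} → ¬ (s ∈ Δ) → Vis (body s) (s ∷ Δ) t → Vis (var s) Δ t

  _∈c_ : ℕ → Ty m → Set
  i ∈c A = ∃[ t ] (Vis A [] t × prio t ≡ i)

  IsPrio : ℕ → Set
  IsPrio j = ∃[ t ] (prio t ≡ j)

  HasPol : ℕ → Pol → Set
  HasPol i a = ∃[ t ] (prio t ≡ i × pol t ≡ a)

  LargestPrio : ℕ → Set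
  LargestPrio n = IsPrio n × (∀ t → prio t ≤ n)

-- Processes (over m type names and d process variables).
-- Channel names are natural numbers; binders are represented by
-- meta-level functions (P_w is a function of the bound channel w).

data Proc (m d : ℕ) : Set where
  fwd    : ℕ → ℕ → Proc m d                          -- y ← x
  cutP   : (ℕ → Proc m d) → (ℕ → Proc m d) → Proc m d -- (w ← P_w ; Q_w)
  sendR  : ℕ → ℕ → Proc m d → Proc m d
  caseL  : ℕ → (ℕ → Proc m d) → Proc m d
  caseR  : ℕ → (ℕ → Proc m d) → Proc m d
  sendL  : ℕ → ℕ → Proc m d → Proc m d
  close  : ℕ → Proc m d
  wait   : ℕ → Proc m d → Proc m d
  sendRμ : ℕ → Fin m → Proc m d → Proc m d
  caseLμ : ℕ → Fin m → Proc m d → Proc m d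
  caseRν : ℕ → Fin m → Proc m d → Proc m d
  sendLν : ℕ → Fin m → Proc m d → Proc m d
  call   : ℕ → Fin d → Maybe ℕ → Proc m d            -- y ← X ← x̄

-- A program ⟨V,S⟩ over S with d process variables:
-- x̄ : ltype X ⊢ X = body X x̄ y :: (y : rtype X)
record Prog (S : Sig) (d : ℕ) : Set where
  field
    ltype : Fin d → Maybe (Ty (Sig.m S))
    rtype : Fin d → Ty (Sig.m S)
    body  : Fin d → Maybe ℕ → ℕ → Proc (Sig.m S) d

record Sym : Set where
  constructor sym
  field
    ch  : ℕ
    gen : ℕ
    idx : ℕ

data Con : Set where
  _≐_ : Sym → Sym → Con
  _≺_ : Sym → Sym → Con

Cstr : Set₁
Cstr = Con → Set

_∪_ : Cstr → Cstr → Cstr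
(Ω ∪ Ω') c = Ω c ⊎ Ω' c

data _⊢_≤_ (Ω : Cstr) : Sym → Sym → Set where
  ≤-refl : ∀ {a} → Ω ⊢ a ≤ a
  ≤-eq₁  : ∀ {a b c} → Ω (a ≐ b) → Ω ⊢ b ≤ c → Ω ⊢ a ≤ c
  ≤-eq₂  : ∀ {a b c} → Ω (b ≐ a) → Ω ⊢ b ≤ c → Ω ⊢ a ≤ c
  ≤-lt   : ∀ {a b c} → Ω (a ≺ b) → Ω ⊢ b ≤ c → Ω ⊢ a ≤ c

_⊢_<_ : Cstr → Sym → Sym → Set
Ω ⊢ a < b = ∃[ a' ] ∃[ b' ] (Ω ⊢ a ≤ a' × Ω (a' ≺ b') × Ω ⊢ b' ≤ b)

StrictAcyclic : Cstr → Set
StrictAcyclic Ω = ∀ a → ¬ (Ω ⊢ a < a)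

MentionsCh : ℕ → Con → Set
MentionsCh w (a ≐ b) = Sym.ch a ≡ w ⊎ Sym.ch b ≡ w
MentionsCh w (a ≺ b) = Sym.ch a ≡ w ⊎ Sym.ch b ≡ w

SymOf : ℕ → ℕ → Sym → Set
SymOf x α a = Sym.ch a ≡ x × Sym.gen a ≡ α

MentionsGen : ℕ → ℕ → Con → Set
MentionsGen x α (a ≐ b) = SymOf x α a ⊎ SymOf x α b
MentionsGen x α (a ≺ b) = SymOf x α a ⊎ SymOf x α b

OccCh : ℕ → Cstr → Set
OccCh w Ω = ∃[ c ] (Ω c × MentionsCh w c)

OccGen : ℕ → ℕ → Cstr → Set
OccGen x α Ω = ∃[ c ] (Ω c × MentionsGen x α c)

-- The infinitary generational typing system for a program V over S,
-- where n is (meant to be) the largest priority of S.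

module System (S : Sig) (d : ℕ) (V : Prog S d) (n : ℕ) where
  open Sig S
  open Prog V renaming (body to pbody)

  record Occ : Set where
    constructor occ
    field
      name : ℕ
      gen  : ℕ
      ty   : Ty m

  record Jdg : Set₁ where
    constructor jdg
    field
      Ω   : Cstr
      lft : Maybe Occ
      prc : Proc m d
      rgt : Occ

  chanOf : Maybe Occ → Maybe (ℕ × ℕ)
  chanOf nothing = nothing
  chanOf (just (occ x α _)) = just (x , α)

  NotLeftName : ℕ → Maybe Occ → Set
  NotLeftName w nothing = ⊤
  NotLeftName w (just (occ x _ _)) = w ≢ x

  rC : ℕ → Ty m → Maybe (ℕ × ℕ) → Cstr
  rC w A nothing c = ⊥
  rC w A (just (x , α)) c =
    ∃[ i ] (1 ≤ i × i ≤ n × ¬ (_∈c_ S i A) × c ≡ (sym w 0 i ≐ sym x α i))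

  EqExcept : ℕ → ℕ → ℕ → ℕ → ℕ → Cstr
  EqExcept a α b β p c =
    ∃[ j ] (IsPrio S j × j ≢ p × c ≡ (sym a α j ≐ sym b β j))

  Single : Con → Cstr
  Single c c' = c' ≡ c

  data Inst : Jdg → Set₁ where
    Id   : ∀ {Ω x α y β A} →
           Inst (jdg Ω (just (occ x α A)) (fwd y x) (occ y β A))
    Cut  : ∀ {Ω L y β C} (P Q : ℕ → Proc m d) (w : ℕ) (A : Ty m) →
           ¬ OccCh w Ω → NotLeftName w L → w ≢ y →
           Inst (jdg Ω L (cutP P Q) (occ y β C))
    ⊕R   : ∀ {Ω L y β K f} (k : Fin K) (P : Proc m d) →
           Inst (jdg Ω L (sendR y (toℕ k) P) (occ y β (plus K f)))
    ⊕L   : ∀ {Ω x α K f R} (Qs : ℕ → Proc m d) →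
           Inst (jdg Ω (just (occ x α (plus K f))) (caseL x Qs) R)
    &R   : ∀ {Ω L y β K f} (Ps : ℕ → Proc m d) →
           Inst (jdg Ω L (caseR y Ps) (occ y β (wth K f)))
    &L   : ∀ {Ω x α K f R} (k : Fin K) (Q : Proc m d) →
           Inst (jdg Ω (just (occ x α (wth K f))) (sendL x (toℕ k) Q) R)
    1R   : ∀ {Ω y β} →
           Inst (jdg Ω nothing (close y) (occ y β one))
    1L   : ∀ {Ω x α R} (Q : Proc m d) →
           Inst (jdg Ω (just (occ x α one)) (wait x Q) R)
    μR   : ∀ {Ω L y β} (t : Fin m) (P : Proc m d) → pol t ≡ μ →
           ¬ OccGen y (suc β) Ω →
           Inst (jdg Ω L (sendRμ y t P) (occ y β (var t)))
    μL   : ∀ {Ω x α R} (t : Fin m) (Q : Proc m d) → pol t ≡ μ →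
           ¬ OccGen x (suc α) Ω →
           Inst (jdg Ω (just (occ x α (var t))) (caseLμ x t Q) R)
    νR   : ∀ {Ω L y β} (t : Fin m) (P : Proc m d) → pol t ≡ ν →
           ¬ OccGen y (suc β) Ω →
           Inst (jdg Ω L (caseRν y t P) (occ y β (var t)))
    νL   : ∀ {Ω x α R} (t : Fin m) (Q : Proc m d) → pol t ≡ ν →
           ¬ OccGen x (suc α) Ω →
           Inst (jdg Ω (just (occ x α (var t))) (sendLν x t Q) R)
    Def  : ∀ {Ω L y β} (X : Fin d) → Maybe.map Occ.ty L ≡ ltype X →
           Inst (jdg Ω L (call y X (Maybe.map Occ.name L)) (occ y β (rtype X)))

  Prem : ∀ {J} → Inst J → Set
  Prem Id = ⊥
  Prem (Cut _ _ _ _ _ _ _) = Bool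
  Prem (⊕R _ _) = ⊤
  Prem (⊕L {K = K} _) = Fin K
  Prem (&R {K = K} _) = Fin K
  Prem (&L _ _) = ⊤
  Prem 1R = ⊥
  Prem (1L _) = ⊤
  Prem (μR _ _ _ _) = ⊤
  Prem (μL _ _ _ _) = ⊤
  Prem (νR _ _ _ _) = ⊤
  Prem (νL _ _ _ _) = ⊤
  Prem (Def _ _) = ⊤

  prem : ∀ {J} (r : Inst J) → Prem r → Jdg
  prem (Cut {Ω} {L} {y} {β} P Q w A _ _ _) true =
    jdg (Ω ∪ rC w A (just (y , β))) L (P w) (occ w 0 A)
  prem (Cut {Ω} {L} {y} {β} {C} P Q w A _ _ _) false =
    jdg (Ω ∪ rC w A (chanOf L)) (just (occ w 0 A)) (Q w) (occ y β C)
  prem (⊕R {Ω} {L} {y} {β} {f = f} k P) _ = jdg Ω L P (occ y β (f k))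
  prem (⊕L {Ω} {x} {α} {f = f} {R} Qs) ℓ =
    jdg Ω (just (occ x α (f ℓ))) (Qs (toℕ ℓ)) R
  prem (&R {Ω} {L} {y} {β} {f = f} Ps) ℓ = jdg Ω L (Ps (toℕ ℓ)) (occ y β (f ℓ))
  prem (&L {Ω} {x} {α} {f = f} {R} k Q) _ = jdg Ω (just (occ x α (f k))) Q R
  prem (1L {Ω} {R = R} Q) _ = jdg Ω nothing Q R
  prem (μR {Ω} {L} {y} {β} t P _ _) _ =
    jdg (Ω ∪ EqExcept y β y (suc β) (prio t)) L P (occ y (suc β) (body t))
  prem (μL {Ω} {x} {α} {R} t Q _ _) _ =
    jdg ((Ω ∪ Single (sym x (suc α) (prio t) ≺ sym x α (prio t)))
           ∪ EqExcept x (suc α) x α (prio t))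
        (just (occ x (suc α) (body t))) Q R
  prem (νR {Ω} {L} {y} {β} t P _ _) _ =
    jdg ((Ω ∪ Single (sym y (suc β) (prio t) ≺ sym y β (prio t)))
           ∪ EqExcept y (suc β) y β (prio t))
        L P (occ y (suc β) (body t))
  prem (νL {Ω} {x} {α} {R} t Q _ _) _ =
    jdg (Ω ∪ EqExcept x (suc α) x α (prio t))
        (just (occ x (suc α) (body t))) Q R
  prem (Def {Ω} {L} {y} {β} X _) _ =
    jdg Ω L (pbody X (Maybe.map Occ.name L) y) (occ y β (rtype X))

  -- (possibly infinite) derivations of J, presented as a tree coalgebra:
  -- every node carries a rule instance concluding its judgment and has
  -- one child node for each premise; the derivation is the unfolding
  -- from the root.
  record Deriv (J : Jdg) : Set₂ where
    field
      Node : Jdg → Set₁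
      root : Node J
      rule : ∀ {J'} → Node J' → Inst J'
      kid  : ∀ {J'} (v : Node J') (k : Prem (rule v)) → Node (prem (rule v) k)
  open Deriv public

  data PathFrom {J₀ : Jdg} (D : Deriv J₀) : ∀ {J} → Node D J → Jdg → Set₂ where
    here  : ∀ {J} {v : Node D J} → PathFrom D v J
    there : ∀ {J J'} {v : Node D J} (k : Prem (rule D v)) →
            PathFrom D (kid D v k) J' → PathFrom D v J'

  Path : ∀ {J} → Deriv J → Jdg → Set₂
  Path D J' = PathFrom D (root D) J'

  Applied : (∀ {J} → Inst J → Set) → ∀ {J₀} {D : Deriv J₀} {J J'} {v : Node D J} →
            PathFrom D v J' → Set
  Applied Q here = ⊥
  Applied Q {D = D} (there {v = v} k p) = Q (rule D v) ⊎ Applied Q p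

  MuLWith : ℕ → ∀ {J} → Inst J → Set
  MuLWith i (μL t _ _ _) = prio t ≡ i
  MuLWith i _ = ⊥

  NuLWith : ℕ → ∀ {J} → Inst J → Set
  NuLWith i (νL t _ _ _) = prio t ≡ i
  NuLWith i _ = ⊥

  NameIn : Jdg → ℕ → Set
  NameIn (jdg Ω L _ (occ y _ _)) w =
    OccCh w Ω ⊎ (¬ NotLeftName w L) ⊎ w ≡ y

  -- variable convention along a path: every channel bound by a cut
  -- applied on the path is fresh w.r.t. all earlier judgments of the path
  CutFresh : (ℕ → Set) → ∀ {J} → Inst J → Set
  CutFresh seen (Cut _ _ w _ _ _ _) = ¬ seen w
  CutFresh seen _ = ⊤

  HygFrom : (ℕ → Set) → ∀ {J₀} {D : Deriv J₀} {J J'} {v : Node D J} →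
            PathFrom D v J' → Set
  HygFrom seen here = ⊤
  HygFrom seen {D = D} (there {v = v} k p) =
    CutFresh seen (rule D v) × HygFrom (λ w → seen w ⊎ NameIn (prem (rule D v) k) w) p

  Hygienic : ∀ {J J'} {D : Deriv J} → Path D J' → Set
  Hygienic {J} p = HygFrom (NameIn J) p

  DistinctChans : Jdg → Set
  DistinctChans (jdg _ L _ (occ y _ _)) = NotLeftName y L

-- The proof is an invariant argument.  We track, along the path, the left
-- channel x^γ : B of each judgment relative to the origin z^α : A (record
-- Tracks): if some x^γ_i reaches z^α_i by a chain of constraints then x = z
-- (when i is visible in B), a strict chain needs a μL rule of priority i
-- applied so far, and no chain exists at a priority c of an applied νL rule.
-- Every rule preserves this, because each rule extends the constraint set
-- only by constraints on fresh symbols (a new generation, or the fresh cut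
-- channel) linked to older ones.  The general fact behind this is the
-- extension lemma reduce: a chain through such an extension either stays
-- in the old constraints, or, when it starts at a fresh symbol, begins with
-- that symbol's link.
-- The invariant holds at every priority.
module Submission where

open import Defs
open import Data.Nat using (ℕ; suc; _≤_; _<_)
open import Data.Nat.Properties using (m≤n⇒m≤1+n; 1+n≰n; 1+n≢n) renaming (≤-refl to ≤ℕ-refl)
open import Data.Fin using (Fin; _≟_)
open import Data.Bool using (Bool; true; false; _∨_; not)
open import Data.Maybe using (Maybe; just; nothing)
open import Data.List using (_∷_)
open import Data.List.Relation.Unary.Any using (here; there)
open import Data.List.Membership.Propositional using (_∈_)
open import Data.List.Relation.Binary.Subset.Propositional using (_⊆_)
open import Data.List.Relation.Binary.Subset.Propositional.Properties using (xs⊆x∷xs; ∷⁺ʳ; ∈-∷⁺ʳ)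
open import Data.Product using (∃-syntax; _×_; _,_; proj₁; proj₂; map₂)
open import Data.Sum using (_⊎_; inj₁; inj₂; [_,_]; map₁; assocʳ; assocˡ)
open import Data.Unit using (⊤; tt)
open import Data.Empty using (⊥; ⊥-elim)
open import Function using (id)
open import Relation.Nullary using (¬_; yes; no; contradiction)
open import Relation.Binary.PropositionalEquality using (_≡_; _≢_; refl; subst) renaming (sym to ≡-sym)

data Chain (Ω : Cstr) : Bool → Sym → Sym → Set where
  done : ∀ {a} → Chain Ω false a a
  eq₁  : ∀ {s a b c} → Ω (a ≐ b) → Chain Ω s b c → Chain Ω s a c
  eq₂  : ∀ {s a b c} → Ω (b ≐ a) → Chain Ω s b c → Chain Ω s a c
  lt   : ∀ {s a b c} → Ω (a ≺ b) → Chain Ω s b c → Chain Ω true a c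

module _ {Ω : Cstr} where

  ≤⇒Chain : ∀ {a b} → Ω ⊢ a ≤ b → ∃[ s ] Chain Ω s a b
  ≤⇒Chain ≤-refl      = false , done
  ≤⇒Chain (≤-eq₁ h q) = map₂ (eq₁ h) (≤⇒Chain q)
  ≤⇒Chain (≤-eq₂ h q) = map₂ (eq₂ h) (≤⇒Chain q)
  ≤⇒Chain (≤-lt h q)  = true , lt h (proj₂ (≤⇒Chain q))

  <⇒Chain : ∀ {a c} → Ω ⊢ a < c → Chain Ω true a c
  <⇒Chain {c = c} (a' , b' , p , h , q) = prefix p
    where
    prefix : ∀ {a} → Ω ⊢ a ≤ a' → Chain Ω true a c
    prefix ≤-refl      = lt h (proj₂ (≤⇒Chain q))
    prefix (≤-eq₁ e r) = eq₁ e (prefix r)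
    prefix (≤-eq₂ e r) = eq₂ e (prefix r)
    prefix (≤-lt e r)  = lt e (prefix r)

  Chain⇒≤ : ∀ {s a b} → Chain Ω s a b → Ω ⊢ a ≤ b
  Chain⇒≤ done       = ≤-refl
  Chain⇒≤ (eq₁ h q) = ≤-eq₁ h (Chain⇒≤ q)
  Chain⇒≤ (eq₂ h q) = ≤-eq₂ h (Chain⇒≤ q)
  Chain⇒≤ (lt h q)  = ≤-lt h (Chain⇒≤ q)

  <-prepend : ∀ {a b d} → (∀ {c} → Ω ⊢ b ≤ c → Ω ⊢ a ≤ c) → Ω ⊢ b < d → Ω ⊢ a < d
  <-prepend f (b' , c' , p , h , q) = b' , c' , f p , h , q

  Chain⇒< : ∀ {a b} → Chain Ω true a b → Ω ⊢ a < b
  Chain⇒< (eq₁ h q) = <-prepend (≤-eq₁ h) (Chain⇒< q)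
  Chain⇒< (eq₂ h q) = <-prepend (≤-eq₂ h) (Chain⇒< q)
  Chain⇒< (lt {b = b} h q) = _ , b , ≤-refl , h , Chain⇒≤ q

record Extension (Ω Ω' : Cstr) (New : Sym → Set) (Link : Sym → Sym → Bool → Set) : Set where
  field
    split≐   : ∀ {a b} → Ω' (a ≐ b) → Ω (a ≐ b) ⊎ Link a b false ⊎ Link b a false
    split≺   : ∀ {a b} → Ω' (a ≺ b) → Ω (a ≺ b) ⊎ Link a b true
    fresh≐   : ∀ {a b} → Ω (a ≐ b) → ¬ New a × ¬ New b
    fresh≺   : ∀ {a b} → Ω (a ≺ b) → ¬ New a × ¬ New b
    link-new : ∀ {a o s} → Link a o s → New a × ¬ New o
    link-fun : ∀ {a o o' s s'} → Link a o s → Link a o' s' → o ≡ o' × s ≡ s'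

record Departs (Ω : Cstr) (Link : Sym → Sym → Bool → Set) (s : Bool) (a c : Sym) : Set where
  constructor departs
  field
    {target} : Sym
    {s₁ s₂}  : Bool
    link     : Link a target s₁
    rest     : Chain Ω s₂ target c
    flag     : s ≡ s₁ ∨ s₂

module _ {Ω Ω' New Link} (E : Extension Ω Ω' New Link) where
  open Extension E

  Reduct : Bool → Sym → Sym → Set
  Reduct s a c = (¬ New a → Chain Ω s a c) × (New a → Departs Ω Link s a c)

  -- a chain that enters a New symbol b from its link target a must return to a
  return : ∀ {s a b c} → Link b a false → Reduct s b c → Chain Ω s a c
  return l r with proj₂ r (proj₁ (link-new l))
  ... | departs l' q e with link-fun l l'
  ...   | refl , refl = subst (λ s → Chain Ω s _ _) (≡-sym e) q

  reduce : ∀ {s a c} → ¬ New c → Chain Ω' s a c → Reduct s a c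
  reduce nc done = (λ _ → done) , (λ na → contradiction na nc)
  reduce nc (eq₁ h q) with split≐ h | reduce nc q
  ... | inj₁ ω        | r = (λ _ → eq₁ ω (proj₁ r (proj₂ (fresh≐ ω))))
                          , (λ na → contradiction na (proj₁ (fresh≐ ω)))
  ... | inj₂ (inj₁ l) | r = (λ na → contradiction (proj₁ (link-new l)) na)
                          , (λ _ → departs l (proj₁ r (proj₂ (link-new l))) refl)
  ... | inj₂ (inj₂ l) | r = (λ _ → return l r) , (λ na → contradiction na (proj₂ (link-new l)))
  reduce nc (eq₂ h q) with split≐ h | reduce nc q
  ... | inj₁ ω        | r = (λ _ → eq₂ ω (proj₁ r (proj₁ (fresh≐ ω))))
                          , (λ na → contradiction na (proj₂ (fresh≐ ω)))
  ... | inj₂ (inj₂ l) | r = (λ na → contradiction (proj₁ (link-new l)) na)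
                          , (λ _ → departs l (proj₁ r (proj₂ (link-new l))) refl)
  ... | inj₂ (inj₁ l) | r = (λ _ → return l r) , (λ na → contradiction na (proj₂ (link-new l)))
  reduce nc (lt h q) with split≺ h | reduce nc q
  ... | inj₁ ω | r = (λ _ → lt ω (proj₁ r (proj₂ (fresh≺ ω))))
                   , (λ na → contradiction na (proj₁ (fresh≺ ω)))
  ... | inj₂ l | r = (λ na → contradiction (proj₁ (link-new l)) na)
                   , (λ _ → departs l (proj₁ r (proj₂ (link-new l))) refl)

  old-chain : ∀ {s a c} → ¬ New a → ¬ New c → Chain Ω' s a c → Chain Ω s a c
  old-chain na nc q = proj₁ (reduce nc q) na

  new-chain : ∀ {s a c} → New a → ¬ New c → Chain Ω' s a c → Departs Ω Link s a c
  new-chain na nc q = proj₂ (reduce nc q) na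

data GenLink (x γ p : ℕ) : Bool → Sym → Sym → Bool → Set where
  keeps : ∀ {d i} → i ≢ p → GenLink x γ p d (sym x (suc γ) i) (sym x γ i) false
  drops : GenLink x γ p true (sym x (suc γ) p) (sym x γ p) true

genExtension : ∀ {Ω Ω' x γ p d} → ¬ OccGen x (suc γ) Ω →
  (∀ {a b} → Ω' (a ≐ b) → Ω (a ≐ b) ⊎ GenLink x γ p d a b false ⊎ GenLink x γ p d b a false) →
  (∀ {a b} → Ω' (a ≺ b) → Ω (a ≺ b) ⊎ GenLink x γ p d a b true) →
  Extension Ω Ω' (SymOf x (suc γ)) (GenLink x γ p d)
genExtension {Ω} {Ω'} {x} {γ} {p} {d} nocc split≐ split≺ = record
  { split≐ = split≐ ; split≺ = split≺
  ; fresh≐ = λ ω → (λ e → nocc (_ , ω , inj₁ e)) , (λ e → nocc (_ , ω , inj₂ e))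
  ; fresh≺ = λ ω → (λ e → nocc (_ , ω , inj₁ e)) , (λ e → nocc (_ , ω , inj₂ e))
  ; link-new = link-new ; link-fun = link-fun }
  where
  older : ∀ i → ¬ SymOf x (suc γ) (sym x γ i)
  older _ (_ , γ≡1+γ) = 1+n≢n (≡-sym γ≡1+γ)
  link-new : ∀ {a o s} → GenLink x γ p d a o s → SymOf x (suc γ) a × ¬ SymOf x (suc γ) o
  link-new (keeps {i = i} _) = (refl , refl) , older i
  link-new drops             = (refl , refl) , older p
  link-fun : ∀ {a o o' s s'} → GenLink x γ p d a o s → GenLink x γ p d a o' s' → o ≡ o' × s ≡ s'
  link-fun (keeps _)  (keeps _)  = refl , refl
  link-fun (keeps i≢p) drops     = contradiction refl i≢p
  link-fun drops      (keeps i≢p) = contradiction refl i≢p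
  link-fun drops      drops      = refl , refl

Apart : ℕ → Maybe (ℕ × ℕ) → Set
Apart w nothing        = ⊤
Apart w (just (v , _)) = v ≢ w

module Visibility (S : Sig) where
  open Sig S

  vis-anti : ∀ {A Δ Δ' t} → Vis S A Δ t → Δ' ⊆ Δ → Vis S A Δ' t
  vis-anti (v-plus ℓ h)       Δ'⊆Δ = v-plus ℓ (vis-anti h Δ'⊆Δ)
  vis-anti (v-wth ℓ h)        Δ'⊆Δ = v-wth ℓ (vis-anti h Δ'⊆Δ)
  vis-anti v-self             Δ'⊆Δ = v-self
  vis-anti (v-unf {s = s} s∉Δ h) Δ'⊆Δ = v-unf (λ s∈Δ' → s∉Δ (Δ'⊆Δ s∈Δ')) (vis-anti h (∷⁺ʳ s Δ'⊆Δ))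

  vis-split : ∀ {A Δ t} s → Vis S A Δ t → Vis S A (s ∷ Δ) t ⊎ Vis S (var s) Δ t
  vis-split s (v-plus ℓ h) = map₁ (v-plus ℓ) (vis-split s h)
  vis-split s (v-wth ℓ h)  = map₁ (v-wth ℓ)(vis-split s h)
  vis-split s v-self       = inj₁ v-self
  vis-split {Δ = Δ} s (v-unf {s = s'} s'∉Δ h) with s' ≟ s
  ... | yes refl = inj₂ (v-unf s'∉Δ h)
  ... | no s'≢s with vis-split s h
  ...   | inj₁ h' = inj₁ (v-unf s'∉s∷Δ (vis-anti h' swap))
    where
    s'∉s∷Δ : ¬ (s' ∈ s ∷ Δ)
    s'∉s∷Δ (here e)   = s'≢s e
    s'∉s∷Δ (there s'∈Δ) = s'∉Δ s'∈Δ
    swap : s' ∷ s ∷ Δ ⊆ s ∷ s' ∷ Δ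
    swap = ∈-∷⁺ʳ (there (here refl)) (∷⁺ʳ s (xs⊆x∷xs Δ s'))
  ...   | inj₂ h' = inj₂ (vis-anti h' (xs⊆x∷xs Δ s'))

  unfold∈c : ∀ {i s} → _∈c_ S i (body s) → _∈c_ S i (var s)
  unfold∈c {s = s} (t , h , e) with vis-split s h
  ... | inj₁ h' = t , v-unf (λ ()) h' , e
  ... | inj₂ h' = t , h' , e

  self∈c : ∀ t → _∈c_ S (prio t) (var t)
  self∈c t = t , v-self , refl

  plus∈c : ∀ {i k f} (ℓ : Fin k) → _∈c_ S i (f ℓ) → _∈c_ S i (plus k f)
  plus∈c ℓ (t , h , e) = t , v-plus ℓ h , e

  wth∈c : ∀ {i k f} (ℓ : Fin k) → _∈c_ S i (f ℓ) → _∈c_ S i (wth k f)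
  wth∈c ℓ (t , h , e) = t , v-wth ℓ h , e

When : Bool → Set → Set
When true  X = X
When false _ = ⊥

when-out : ∀ d {X} → When d X → X
when-out true  x = x
when-out false ()

module Generational (S : Sig) (d : ℕ) (V : Prog S d) (n : ℕ) where
  open Sig S
  open System S d V n
  open Visibility S

  descending : ∀ {Ω x γ p} → ¬ OccGen x (suc γ) Ω →
    Extension Ω ((Ω ∪ Single (sym x (suc γ) p ≺ sym x γ p)) ∪ EqExcept x (suc γ) x γ p)
              (SymOf x (suc γ)) (GenLink x γ p true)
  descending {Ω} {x} {γ} {p} nocc = genExtension nocc split≐ split≺
    where
    Ω' = (Ω ∪ Single (sym x (suc γ) p ≺ sym x γ p)) ∪ EqExcept x (suc γ) x γ p
    split≐ : ∀ {a b} → Ω' (a ≐ b) → Ω (a ≐ b) ⊎ GenLink x γ p true a b false ⊎ GenLink x γ p true b a false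
    split≐ (inj₁ (inj₁ ω))              = inj₁ ω
    split≐ (inj₁ (inj₂ ()))
    split≐ (inj₂ (_ , _ , j≢p , refl)) = inj₂ (inj₁ (keeps j≢p))
    split≺ : ∀ {a b} → Ω' (a ≺ b) → Ω (a ≺ b) ⊎ GenLink x γ p true a b true
    split≺ (inj₁ (inj₁ ω))    = inj₁ ω
    split≺ (inj₁ (inj₂ refl)) = inj₂ drops
    split≺ (inj₂ (_ , _ , _ , ()))

  level : ∀ {Ω x γ p} → ¬ OccGen x (suc γ) Ω →
    Extension Ω (Ω ∪ EqExcept x (suc γ) x γ p) (SymOf x (suc γ)) (GenLink x γ p false)
  level {Ω} {x} {γ} {p} nocc = genExtension nocc split≐ split≺
    where
    split≐ : ∀ {a b} → (Ω ∪ EqExcept x (suc γ) x γ p) (a ≐ b) →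
             Ω (a ≐ b) ⊎ GenLink x γ p false a b false ⊎ GenLink x γ p false b a false
    split≐ (inj₁ ω)                    = inj₁ ω
    split≐ (inj₂ (_ , _ , j≢p , refl)) = inj₂ (inj₁ (keeps j≢p))
    split≺ : ∀ {a b} → (Ω ∪ EqExcept x (suc γ) x γ p) (a ≺ b) → Ω (a ≺ b) ⊎ GenLink x γ p false a b true
    split≺ (inj₁ ω) = inj₁ ω
    split≺ (inj₂ (_ , _ , _ , ()))

  levelʳ : ∀ {Ω y β p} → ¬ OccGen y (suc β) Ω →
    Extension Ω (Ω ∪ EqExcept y β y (suc β) p) (SymOf y (suc β)) (GenLink y β p false)
  levelʳ {Ω} {y} {β} {p} nocc = genExtension nocc split≐ split≺
    where
    split≐ : ∀ {a b} → (Ω ∪ EqExcept y β y (suc β) p) (a ≐ b) →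
             Ω (a ≐ b) ⊎ GenLink y β p false a b false ⊎ GenLink y β p false b a false
    split≐ (inj₁ ω)                    = inj₁ ω
    split≐ (inj₂ (_ , _ , j≢p , refl)) = inj₂ (inj₂ (keeps j≢p))
    split≺ : ∀ {a b} → (Ω ∪ EqExcept y β y (suc β) p) (a ≺ b) → Ω (a ≺ b) ⊎ GenLink y β p false a b true
    split≺ (inj₁ ω) = inj₁ ω
    split≺ (inj₂ (_ , _ , _ , ()))

  data CutLink (w : ℕ) (A₁ : Ty m) : Maybe (ℕ × ℕ) → Sym → Sym → Bool → Set where
    share : ∀ {v δ i} → ¬ _∈c_ S i A₁ → CutLink w A₁ (just (v , δ)) (sym w 0 i) (sym v δ i) false

  cutExtension : ∀ {Ω w A₁ mv} → ¬ OccCh w Ω → Apart w mv →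
    Extension Ω (Ω ∪ rC w A₁ mv) (λ a → Sym.ch a ≡ w) (CutLink w A₁ mv)
  cutExtension {Ω} {w} {A₁} {mv} nocc apart = record
    { split≐ = split≐ mv ; split≺ = split≺ mv
    ; fresh≐ = λ ω → (λ e → nocc (_ , ω , inj₁ e)) , (λ e → nocc (_ , ω , inj₂ e))
    ; fresh≺ = λ ω → (λ e → nocc (_ , ω , inj₁ e)) , (λ e → nocc (_ , ω , inj₂ e))
    ; link-new = link-new apart ; link-fun = link-fun }
    where
    split≐ : ∀ mv {a b} → (Ω ∪ rC w A₁ mv) (a ≐ b) →
             Ω (a ≐ b) ⊎ CutLink w A₁ mv a b false ⊎ CutLink w A₁ mv b a false
    split≐ _        (inj₁ ω)                         = inj₁ ω
    split≐ (just _) (inj₂ (_ , _ , _ , i∉A₁ , refl)) = inj₂ (inj₁ (share i∉A₁))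
    split≺ : ∀ mv {a b} → (Ω ∪ rC w A₁ mv) (a ≺ b) → Ω (a ≺ b) ⊎ CutLink w A₁ mv a b true
    split≺ _        (inj₁ ω) = inj₁ ω
    split≺ (just _) (inj₂ (_ , _ , _ , _ , ()))
    link-new : ∀ {mv a o s} → Apart w mv → CutLink w A₁ mv a o s → Sym.ch a ≡ w × ¬ Sym.ch o ≡ w
    link-new v≢w (share _) = refl , v≢w
    link-fun : ∀ {a o o' s s'} → CutLink w A₁ mv a o s → CutLink w A₁ mv a o' s' → o ≡ o' × s ≡ s'
    link-fun (share _) (share _) = refl , refl

  apart : ∀ {w} L → NotLeftName w L → Apart w (chanOf L)
  apart nothing              _   = tt
  apart (just (occ x _ _)) w≢x = λ x≡w → w≢x (≡-sym x≡w)

  module Origin (z α : ℕ) (A : Ty m) where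

    -- the left channel x^γ : B of a judgment with constraints Ω, where Fμ
    -- and Fν hold of the priorities of the μL and νL rules applied so far
    record Tracks (Ω : Cstr) (x γ : ℕ) (B : Ty m) (Fμ Fν : ℕ → Set) : Set where
      field
        later    : x ≡ z → α ≤ γ
        visible  : x ≡ z → ∀ i → _∈c_ S i B → _∈c_ S i A
        only-z   : ∀ {s} i → _∈c_ S i B → Chain Ω s (sym x γ i) (sym z α i) → x ≡ z
        strict   : ∀ i → Chain Ω true (sym x γ i) (sym z α i) → _∈c_ S i A × Fμ i
        avoids-ν : ∀ {s} c → Fν c → ¬ Chain Ω s (sym x γ c) (sym z α c)
    open Tracks

    LeftTracks : Cstr → Maybe Occ → (ℕ → Set) → (ℕ → Set) → Set
    LeftTracks Ω nothing             _  _  = ⊤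
    LeftTracks Ω (just (occ x γ B)) Fμ Fν = Tracks Ω x γ B Fμ Fν

    Inv : Jdg → (ℕ → Set) → (ℕ → Set) → Set
    Inv (jdg Ω L _ (occ y _ _)) Fμ Fν = y ≢ z × NotLeftName y L × LeftTracks Ω L Fμ Fν

    Tracks-mono : ∀ {Ω Ω' x γ B Fμ Fν Gμ Gν} →
      (∀ {s i} → Chain Ω' s (sym x γ i) (sym z α i) → Chain Ω s (sym x γ i) (sym z α i)) →
      (∀ i → Fμ i → Gμ i) → (∀ c → Gν c → Fν c) →
      Tracks Ω x γ B Fμ Fν → Tracks Ω' x γ B Gμ Gν
    Tracks-mono back fμ fν tr = record
      { later = later tr ; visible = visible tr
      ; only-z = λ i v q → only-z tr i v (back q)
      ; strict = λ i q → map₂ (fμ i) (strict tr i (back q))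
      ; avoids-ν = λ c g q → avoids-ν tr c (fν c g) (back q) }

    LeftTracks-mono : ∀ {Ω Fμ Fν Gμ Gν} L → (∀ i → Fμ i → Gμ i) → (∀ c → Gν c → Fν c) →
      LeftTracks Ω L Fμ Fν → LeftTracks Ω L Gμ Gν
    LeftTracks-mono nothing            fμ fν _  = tt
    LeftTracks-mono (just (occ _ _ _)) fμ fν tr = Tracks-mono id fμ fν tr

    Inv-mono : ∀ {J Fμ Fν Gμ Gν} → (∀ i → Fμ i → Gμ i) → (∀ c → Gν c → Fν c) → Inv J Fμ Fν → Inv J Gμ Gν
    Inv-mono {jdg _ L _ _} fμ fν (y≢z , y∉L , tr) = y≢z , y∉L , LeftTracks-mono L fμ fν tr

    unrecorded : ∀ {Ω Fμ Fν} L → LeftTracks Ω L Fμ Fν → LeftTracks Ω L (λ i → Fμ i ⊎ ⊥) (λ c → Fν c ⊎ ⊥)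
    unrecorded L = LeftTracks-mono L (λ _ → inj₁) (λ _ → [ id , ⊥-elim ])

    narrow : ∀ {Ω x γ B B' Fμ Fν} → (∀ i → _∈c_ S i B' → _∈c_ S i B) →
      Tracks Ω x γ B Fμ Fν → Tracks Ω x γ B' Fμ Fν
    narrow B'⊆B tr = record
      { later = later tr ; visible = λ e i v → visible tr e i (B'⊆B i v)
      ; only-z = λ i v → only-z tr i (B'⊆B i v)
      ; strict = strict tr ; avoids-ν = avoids-ν tr }

    keepLeft : ∀ {Ω Ω' New Link y Fμ Fν} → Extension Ω Ω' New Link → (∀ {a} → New a → Sym.ch a ≡ y) →
      y ≢ z → ∀ L → NotLeftName y L → LeftTracks Ω L Fμ Fν → LeftTracks Ω' L Fμ Fν
    keepLeft E onY y≢z nothing            _   _  = tt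
    keepLeft E onY y≢z (just (occ x γ B)) y≢x tr =
      Tracks-mono (old-chain E (λ new → y≢x (≡-sym (onY new))) (λ new → y≢z (≡-sym (onY new))))
                  (λ _ → id) (λ _ → id) tr

    not-next : ∀ {Ω x γ B Fμ Fν} → Tracks Ω x γ B Fμ Fν → ∀ i → ¬ SymOf x (suc γ) (sym z α i)
    not-next tr i (z≡x , α≡1+γ) = 1+n≰n (subst (_≤ _) α≡1+γ (later tr (≡-sym z≡x)))

    unfoldLeft : ∀ {Ω Ω' x γ Fμ Fν} t (dec : Bool) →
      Extension Ω Ω' (SymOf x (suc γ)) (GenLink x γ (prio t) dec) →
      Tracks Ω x γ (var t) Fμ Fν →
      Tracks Ω' x (suc γ) (body t) (λ i → Fμ i ⊎ When dec (prio t ≡ i))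
                                   (λ c → Fν c ⊎ When (not dec) (prio t ≡ c))
    unfoldLeft {Ω} {Ω'} {x} {γ} {Fμ} {Fν} t dec E tr = record
      { later = λ e → m≤n⇒m≤1+n (later tr e)
      ; visible = λ e i v → visible tr e i (unfold∈c v)
      ; only-z = reach ; strict = strict' ; avoids-ν = avoids }
      where
      leave : ∀ {s} i → Chain Ω' s (sym x (suc γ) i) (sym z α i) →
              Departs Ω (GenLink x γ (prio t) dec) s (sym x (suc γ) i) (sym z α i)
      leave i = new-chain E (refl , refl) (not-next tr i)
      reach : ∀ {s} i → _∈c_ S i (body t) → Chain Ω' s (sym x (suc γ) i) (sym z α i) → x ≡ z
      reach i v q with leave i q
      ... | departs (keeps _) q' _ = only-z tr i (unfold∈c v) q'
      ... | departs drops     q' _ = only-z tr (prio t) (self∈c t) q'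
      strict' : ∀ i → Chain Ω' true (sym x (suc γ) i) (sym z α i) →
                _∈c_ S i A × (Fμ i ⊎ When dec (prio t ≡ i))
      strict' i q with leave i q
      ... | departs (keeps _) q' refl = map₂ inj₁ (strict tr i q')
      ... | departs drops     q' _    =
        visible tr (only-z tr (prio t) (self∈c t) q') (prio t) (self∈c t) , inj₂ refl
      avoids : ∀ {s} c → Fν c ⊎ When (not dec) (prio t ≡ c) → ¬ Chain Ω' s (sym x (suc γ) c) (sym z α c)
      avoids c f q with leave c q | f
      ... | departs (keeps _)   q' _ | inj₁ fν = avoids-ν tr c fν q'
      ... | departs (keeps c≢p) _  _ | inj₂ w  = c≢p (≡-sym (when-out (not dec) w))
      ... | departs drops       q' _ | inj₁ fν = avoids-ν tr (prio t) fν q'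
      ... | departs drops       _  _ | inj₂ ()

    -- the new left channel w^0 : A₁ of the right premise of a cut reaches
    -- z only through r(L), at priorities invisible in A₁
    cutLeft : ∀ {Ω w A₁ Fμ Fν} → ¬ OccCh w Ω → w ≢ z → ∀ L → NotLeftName w L →
      LeftTracks Ω L Fμ Fν → Tracks (Ω ∪ rC w A₁ (chanOf L)) w 0 A₁ Fμ Fν
    cutLeft {Ω} {w} {A₁} {Fμ} {Fν} nocc w≢z L w∉L tr = record
      { later = λ w≡z → contradiction w≡z w≢z ; visible = λ w≡z → contradiction w≡z w≢z
      ; only-z = λ i v q → reach L tr v (leave q)
      ; strict = λ i q → strict' L tr (leave q)
      ; avoids-ν = λ c f q → avoids L tr f (leave q) }
      where
      leave : ∀ {s i} → Chain (Ω ∪ rC w A₁ (chanOf L)) s (sym w 0 i) (sym z α i) →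
              Departs Ω (CutLink w A₁ (chanOf L)) s (sym w 0 i) (sym z α i)
      leave = new-chain (cutExtension nocc (apart L w∉L)) refl (λ z≡w → w≢z (≡-sym z≡w))
      reach : ∀ {s i} L → LeftTracks Ω L Fμ Fν → _∈c_ S i A₁ →
              Departs Ω (CutLink w A₁ (chanOf L)) s (sym w 0 i) (sym z α i) → w ≡ z
      reach nothing  _ _ (departs () _ _)
      reach (just _) _ v (departs (share i∉A₁) _ _) = contradiction v i∉A₁
      strict' : ∀ {i} L → LeftTracks Ω L Fμ Fν →
                Departs Ω (CutLink w A₁ (chanOf L)) true (sym w 0 i) (sym z α i) → _∈c_ S i A × Fμ i
      strict' nothing  _  (departs () _ _)
      strict' (just _) tr (departs (share _) q refl) = strict tr _ q
      avoids : ∀ {s c} L → LeftTracks Ω L Fμ Fν → Fν c →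
               ¬ Departs Ω (CutLink w A₁ (chanOf L)) s (sym w 0 c) (sym z α c)
      avoids nothing  _  _ (departs () _ _)
      avoids (just _) tr f (departs (share _) q _) = avoids-ν tr _ f q

    fresh-differs : ∀ {w} (seen : ℕ → Set) → seen z → ¬ seen w → w ≢ z
    fresh-differs seen sz w-unseen w≡z = w-unseen (subst seen (≡-sym w≡z) sz)

    step : ∀ {J Fμ Fν} (seen : ℕ → Set) → seen z → (r : Inst J) (k : Prem r) → CutFresh seen r →
      Inv J Fμ Fν → Inv (prem r k) (λ i → Fμ i ⊎ MuLWith i r) (λ c → Fν c ⊎ NuLWith c r)
    step seen sz Id () _ _
    step seen sz 1R () _ _
    step seen sz (Cut {L = L} _ _ w _ nocc w∉L w≢y) true fresh (y≢z , y∉L , tr) =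
      w≢z , w∉L , unrecorded L (keepLeft (cutExtension nocc (λ y≡w → w≢y (≡-sym y≡w))) id w≢z L w∉L tr)
      where w≢z = fresh-differs seen sz fresh
    step seen sz (Cut {L = L} _ _ w _ nocc w∉L w≢y) false fresh (y≢z , y∉L , tr) =
      y≢z , (λ y≡w → w≢y (≡-sym y≡w)) , unrecorded (just _) (cutLeft nocc w≢z L w∉L tr)
      where w≢z = fresh-differs seen sz fresh
    step seen sz (⊕R {L = L} _ _) _ _ (y≢z , y∉L , tr) = y≢z , y∉L , unrecorded L tr
    step seen sz (&R {L = L} _)   _ _ (y≢z , y∉L , tr) = y≢z , y∉L , unrecorded L tr
    step seen sz (Def {L = L} _ _) _ _ (y≢z , y∉L , tr) = y≢z , y∉L , unrecorded L tr
    step seen sz (⊕L _) ℓ _ (y≢z , y∉L , tr) = y≢z , y∉L , unrecorded (just _) (narrow (λ _ → plus∈c ℓ) tr)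
    step seen sz (&L k _) _ _ (y≢z , y∉L , tr) = y≢z , y∉L , unrecorded (just _) (narrow (λ _ → wth∈c k) tr)
    step seen sz (1L _) _ _ (y≢z , _ , _) = y≢z , tt , tt
    step seen sz (μR {L = L} _ _ _ nocc) _ _ (y≢z , y∉L , tr) =
      y≢z , y∉L , unrecorded L (keepLeft (levelʳ nocc) proj₁ y≢z L y∉L tr)
    step seen sz (νR {L = L} _ _ _ nocc) _ _ (y≢z , y∉L , tr) =
      y≢z , y∉L , unrecorded L (keepLeft (descending nocc) proj₁ y≢z L y∉L tr)
    step seen sz (μL t _ _ nocc) _ _ (y≢z , y∉L , tr) = y≢z , y∉L , unfoldLeft t true (descending nocc) tr
    step seen sz (νL t _ _ nocc) _ _ (y≢z , y∉L , tr) = y≢z , y∉L , unfoldLeft t false (level nocc) tr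

    follow : ∀ {J₀} {D : Deriv J₀} {J J'} {v : Node D J} (p : PathFrom D v J') (seen : ℕ → Set) →
      HygFrom seen p → seen z → ∀ {Fμ Fν} → Inv J Fμ Fν →
      Inv J' (λ i → Fμ i ⊎ Applied (MuLWith i) p) (λ c → Fν c ⊎ Applied (NuLWith c) p)
    follow {J = J} here _ _ _ inv = Inv-mono {J} (λ _ → inj₁) (λ _ → [ id , ⊥-elim ]) inv
    follow {D = D} {J' = J'} (there {v = v} k p) seen (fresh , hyg) sz inv =
      Inv-mono {J'} (λ _ → assocʳ) (λ _ → assocˡ) (follow p _ hyg (inj₁ sz) (step seen sz (rule D v) k fresh inv))

    -- at the root the left channel is z^α itself; strict acyclicity rules out
    -- strict chains from z^α_i to itself
    start : ∀ {J} → Jdg.lft J ≡ just (occ z α A) → DistinctChans J → StrictAcyclic (Jdg.Ω J) →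
      Inv J (λ _ → ⊥) (λ _ → ⊥)
    start {jdg Ω _ _ (occ y _ _)} refl y≢z acyclic = y≢z , y≢z , record
      { later = λ _ → ≤ℕ-refl ; visible = λ _ _ v → v ; only-z = λ _ _ _ → refl
      ; strict = λ i q → ⊥-elim (acyclic _ (Chain⇒< q)) ; avoids-ν = λ _ () }

    origin-named : ∀ {J} → Jdg.lft J ≡ just (occ z α A) → NameIn J z
    origin-named {jdg _ _ _ (occ _ _ _)} refl = inj₂ (inj₁ (λ z≢z → z≢z refl))

    left-tracks : ∀ {J x γ B Fμ Fν} → Jdg.lft J ≡ just (occ x γ B) → Inv J Fμ Fν → Tracks (Jdg.Ω J) x γ B Fμ Fν
    left-tracks {jdg _ _ _ (occ _ _ _)} refl (_ , _ , tr) = tr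

lemma6 : (S : Sig) (d : ℕ) (V : Prog S d) (n : ℕ) → LargestPrio S n →
    ∀ {J J'} (D : System.Deriv S d V n J) (P : System.Path S d V n D J') →
    System.DistinctChans S d V n J → StrictAcyclic (System.Jdg.Ω J) →
    System.Hygienic S d V n P →
    ∀ {z α A x γ A'} →
    System.Jdg.lft J ≡ just (System.occ z α A) →
    System.Jdg.lft J' ≡ just (System.occ x γ A') →
    (∀ i → _∈c_ S i A' → HasPol S i μ →
       System.Jdg.Ω J' ⊢ sym x γ i ≤ sym z α i →
       x ≡ z × _∈c_ S i A)
    × (∀ i → i < n →
       System.Jdg.Ω J' ⊢ sym x γ i < sym z α i →
       _∈c_ S i A × System.Applied S d V n (System.MuLWith S d V n i) P)
    × (∀ c → c ≤ n → HasPol S c ν →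
       System.Jdg.Ω J' ⊢ sym x γ c ≤ sym z α c →
       ¬ System.Applied S d V n (System.NuLWith S d V n c) P)
lemma6 S d V n _ {J} {J'} D P distinct acyclic hygienic {z} {α} {A} origin top =
    (λ i v _ q → let x≡z = only-z tr i v (proj₂ (≤⇒Chain q)) in x≡z , visible tr x≡z i v)
  , (λ i _ q → map₂ [ ⊥-elim , id ] (strict tr i (<⇒Chain q)))
  , (λ c _ _ q applied → avoids-ν tr c (inj₂ applied) (proj₂ (≤⇒Chain q)))
  where
  open Generational S d V n
  open Origin z α A
  open Tracks
  tr = left-tracks {J'} top (follow P _ hygienic (origin-named {J} origin) (start {J} origin distinct acyclic))
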